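{- Let $A,B,C,D$ be sets, let $f: A+C \to B+D$ be a bijection (where $+$ denotes disjoint union) and let $g: C \to D$ be a bijection such that $g$ respects $f$, i.e. \[\forall x\in C\;\bigl(f(x)\in D \implies g(x)=f(x)\bigr).\] Define $f\setminus g : A \to B$ by \[(f\setminus g)(x) = \begin{cases} f(x) & \text{if } f(x)\in B,\\ f(g^{ -1}(f(x))) & \text{otherwise.}\end{cases}\] Then $f\setminus g$ is a well-defined bijection from $A$ to $B$. Moreover, $f\setminus g$ respects $f$, i.e. $\forall x\in A\;(f(x)\in B\implies (f\setminus g)(x)=f(x))$, and $f\setminus(f\setminus g)=g$, where for a bijection $h:A\to B$ the map $f\setminus h: C\to D$ is defined by $(f\setminus h)(x)=f(x)$ if $f(x)\in D$ and $(f\setminus h)(x)=f(h^{ -1}(f(x)))$ otherwise.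
   Context: For sets $X_1,X_2,Y_1,Y_2$, a bijection $\varphi:X_1+X_2\to Y_1+Y_2$ and a bijection $\psi:X_2\to Y_2$, one says $\psi$ respects $\varphi$ if $\varphi(x)\in Y_2$ implies $\psi(x)=\varphi(x)$ for all $x\in X_2$. Here $+$ is disjoint union. -}

module Defs where

open import Level using (Level)
open import Data.Sum using (_⊎_; inj₁; inj₂)
open import Function.Bundles using (_↔_; Inverse)
open import Relation.Binary.PropositionalEquality using (_≡_)

private
  variable
    a b c d : Level
    A : Set a
    B : Set b
    C : Set c
    D : Set d

-- A bijection is represented as an Inverse (_↔_) so that the inverse map
-- (written g⁻¹ in the paper) is available as Inverse.from.

RespectsR : (A ⊎ C) ↔ (B ⊎ D) → C ↔ D → Set _
RespectsR {C = C} {D = D} f g =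
  ∀ (x : C) (y : D) → Inverse.to f (inj₂ x) ≡ inj₂ y → Inverse.to g x ≡ y

RespectsL : (A ⊎ C) ↔ (B ⊎ D) → A ↔ B → Set _
RespectsL {A = A} {B = B} f h =
  ∀ (x : A) (y : B) → Inverse.to f (inj₁ x) ≡ inj₁ y → Inverse.to h x ≡ y

-- The raw formula for (f ∖ g) : A → B, with values a priori in B ⊎ D
--   (f∖g)(x) = f(x) if f(x) ∈ B, and f(g⁻¹(f(x))) otherwise.
minusL : (A ⊎ C) ↔ (B ⊎ D) → C ↔ D → A → B ⊎ D
minusL f g x with Inverse.to f (inj₁ x)
... | inj₁ y = inj₁ y
... | inj₂ y = Inverse.to f (inj₂ (Inverse.from g y))

minusR : (A ⊎ C) ↔ (B ⊎ D) → A ↔ B → C → B ⊎ D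
minusR f h x with Inverse.to f (inj₂ x)
... | inj₂ y = inj₂ y
... | inj₁ y = Inverse.to f (inj₁ (Inverse.from h y))

-- For x ∈ A, f ∖ g follows f, and if f x lies in D it makes one detour
-- through g⁻¹ and f; because g respects f this detour always ends in B. The
-- graph of f ∖ g is symmetric under (f , g) ↦ (f⁻¹ , g⁻¹), so the same
-- construction for the inverses inverts f ∖ g, and on C the map f ∖ (f ∖ g)
-- retraces the detours backwards, which is g.
module Submission where

open import Defs
open import Level using (Level; _⊔_)
open import Data.Sum using (_⊎_; inj₁; inj₂)
open import Data.Sum.Properties using (inj₁-injective)
open import Data.Product using (Σ; ∃; _×_; _,_; proj₁; proj₂)
open import Function.Bundles using (_↔_; Inverse; Injection; mk↔ₛ′)
open import Function.Properties.Inverse using (↔-sym; ↔⇒↣)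
open import Relation.Binary.PropositionalEquality using (_≡_; refl; sym; trans; cong)

open Inverse

private
  variable
    a b c d : Level
    A : Set a
    B : Set b
    C : Set c
    D : Set d

data GraphL {a b c d} {A : Set a} {B : Set b} {C : Set c} {D : Set d}
  (f : (A ⊎ C) ↔ (B ⊎ D)) (g : C ↔ D) (x : A) (y : B) : Set (b ⊔ d) where
  direct : to f (inj₁ x) ≡ inj₁ y → GraphL f g x y
  detour : ∀ z → to f (inj₁ x) ≡ inj₂ z → to f (inj₂ (from g z)) ≡ inj₁ y → GraphL f g x y

module _ (f : (A ⊎ C) ↔ (B ⊎ D)) where

  from-to : ∀ {p q} → to f q ≡ p → from f p ≡ q
  from-to e = inverseʳ f (sym e)

  to-from : ∀ {p q} → from f p ≡ q → to f q ≡ p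
  to-from e = inverseˡ f (sym e)

  respectsR-sym : (g : C ↔ D) → RespectsR f g → RespectsR (↔-sym f) (↔-sym g)
  respectsR-sym g resp y x e = inverseʳ g (sym (resp x y (to-from e)))

  minusL-inj₁ : (g : C ↔ D) → ∀ {x y} → to f (inj₁ x) ≡ inj₁ y → minusL f g x ≡ inj₁ y
  minusL-inj₁ g {x} e with to f (inj₁ x)
  minusL-inj₁ g refl | _ = refl

  minusL-inj₂ : (g : C ↔ D) → ∀ {x z} → to f (inj₁ x) ≡ inj₂ z → minusL f g x ≡ to f (inj₂ (from g z))
  minusL-inj₂ g {x} e with to f (inj₁ x)
  minusL-inj₂ g refl | _ = refl

  minusR-inj₂ : (h : A ↔ B) → ∀ {x z} → to f (inj₂ x) ≡ inj₂ z → minusR f h x ≡ inj₂ z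
  minusR-inj₂ h {x} e with to f (inj₂ x)
  minusR-inj₂ h refl | _ = refl

  minusR-inj₁ : (h : A ↔ B) → ∀ {x y} → to f (inj₂ x) ≡ inj₁ y → minusR f h x ≡ to f (inj₁ (from h y))
  minusR-inj₁ h {x} e with to f (inj₂ x)
  minusR-inj₁ h refl | _ = refl

module _ {f : (A ⊎ C) ↔ (B ⊎ D)} {g : C ↔ D} where

  graphL⇒minusL : ∀ {x y} → GraphL f g x y → minusL f g x ≡ inj₁ y
  graphL⇒minusL (direct e)       = minusL-inj₁ f g e
  graphL⇒minusL (detour _ e e′) = trans (minusL-inj₂ f g e) e′

  graphL-functional : ∀ {x y y′} → GraphL f g x y → GraphL f g x y′ → y ≡ y′
  graphL-functional p q = inj₁-injective (trans (sym (graphL⇒minusL p)) (graphL⇒minusL q))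

  graphL-sym : ∀ {x y} → GraphL f g x y → GraphL (↔-sym f) (↔-sym g) y x
  graphL-sym (direct e) = direct (from-to f e)
  graphL-sym (detour z e e′) =
    detour (from g z) (from-to f e′) (trans (cong (λ w → from f (inj₂ w)) (strictlyInverseˡ g z)) (from-to f e))

  graphL-detour : ∀ {x y z} → GraphL f g x y → to f (inj₁ x) ≡ inj₂ z → to f (inj₂ (from g z)) ≡ inj₁ y
  graphL-detour (direct e) e″ with trans (sym e) e″
  ... | ()
  graphL-detour (detour _ e e′) e″ with trans (sym e) e″
  ... | refl = e′

module _ (f : (A ⊎ C) ↔ (B ⊎ D)) (g : C ↔ D) (resp : RespectsR f g) where

  respectsR-from : ∀ {z w} → to f (inj₂ (from g z)) ≡ inj₂ w → w ≡ z
  respectsR-from {z} {w} e = trans (sym (resp (from g z) w e)) (strictlyInverseˡ g z)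

  -- Otherwise respect gives f (g⁻¹ z) = inj₂ z = f x, against injectivity of f.
  detour-lands-in-B : ∀ {x z} → to f (inj₁ x) ≡ inj₂ z → ∃ λ y → to f (inj₂ (from g z)) ≡ inj₁ y
  detour-lands-in-B {x} {z} e with to f (inj₂ (from g z)) in e′
  ... | inj₁ y = y , refl
  ... | inj₂ w with Injection.injective (↔⇒↣ f) (trans e′ (trans (cong inj₂ (respectsR-from e′)) (sym e)))
  ...   | ()

  graphL-total : ∀ x → ∃ (GraphL f g x)
  graphL-total x with to f (inj₁ x) in e
  ... | inj₁ y = y , direct e
  ... | inj₂ z with detour-lands-in-B e
  ...   | y , e′ = y , detour z e e′

  minusL-fun : A → B
  minusL-fun x = proj₁ (graphL-total x)

  graphL-minusL-fun : ∀ x → GraphL f g x (minusL-fun x)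
  graphL-minusL-fun x = proj₂ (graphL-total x)

minusL↔ : (f : (A ⊎ C) ↔ (B ⊎ D)) (g : C ↔ D) → RespectsR f g → A ↔ B
minusL↔ {A = A} {C = C} {B = B} {D = D} f g resp =
  mk↔ₛ′ (minusL-fun f g resp) (minusL-fun f⁻¹ g⁻¹ resp⁻¹) left right
  where
  f⁻¹ : (B ⊎ D) ↔ (A ⊎ C)
  f⁻¹ = ↔-sym f
  g⁻¹ : D ↔ C
  g⁻¹ = ↔-sym g
  resp⁻¹ : RespectsR f⁻¹ g⁻¹
  resp⁻¹ = respectsR-sym f g resp

  left : ∀ y → minusL-fun f g resp (minusL-fun f⁻¹ g⁻¹ resp⁻¹ y) ≡ y
  left y = graphL-functional (graphL-minusL-fun f g resp _) (graphL-sym (graphL-minusL-fun f⁻¹ g⁻¹ resp⁻¹ y))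

  right : ∀ x → minusL-fun f⁻¹ g⁻¹ resp⁻¹ (minusL-fun f g resp x) ≡ x
  right x = graphL-functional (graphL-minusL-fun f⁻¹ g⁻¹ resp⁻¹ _) (graphL-sym (graphL-minusL-fun f g resp x))

module _ (f : (A ⊎ C) ↔ (B ⊎ D)) (g : C ↔ D) (resp : RespectsR f g) where

  minusL↔-minusL : ∀ x → inj₁ (to (minusL↔ f g resp) x) ≡ minusL f g x
  minusL↔-minusL x = sym (graphL⇒minusL (graphL-minusL-fun f g resp x))

  minusL↔-respectsL : RespectsL f (minusL↔ f g resp)
  minusL↔-respectsL x y e = graphL-functional (graphL-minusL-fun f g resp x) (direct e)

  minusR-minusL↔ : ∀ x → minusR f (minusL↔ f g resp) x ≡ inj₂ (to g x)
  minusR-minusL↔ x = by-cases (to f (inj₂ x)) refl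
    where
    h : A ↔ B
    h = minusL↔ f g resp

    by-cases : ∀ u → to f (inj₂ x) ≡ u → minusR f h x ≡ inj₂ (to g x)
    by-cases (inj₂ z) e = trans (minusR-inj₂ f h e) (cong inj₂ (sym (resp x z e)))
    by-cases (inj₁ y) e = trans (minusR-inj₁ f h e) (to-from f back)
      where
      back : from f (inj₂ (to g x)) ≡ inj₁ (from h y)
      back = graphL-detour (graphL-minusL-fun (↔-sym f) (↔-sym g) (respectsR-sym f g resp) y) (from-to f e)

proposition1 : ∀ {a b c d : Level} {A : Set a} {B : Set b} {C : Set c} {D : Set d}
    (f : (A ⊎ C) ↔ (B ⊎ D)) (g : C ↔ D) → RespectsR f g →
    Σ (A ↔ B) (λ h →
      (∀ (x : A) → inj₁ (Inverse.to h x) ≡ minusL f g x)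
      × RespectsL f h
      × (∀ (x : C) → minusR f h x ≡ inj₂ (Inverse.to g x)))
proposition1 f g resp =
  minusL↔ f g resp , minusL↔-minusL f g resp , minusL↔-respectsL f g resp , minusR-minusL↔ f g resp
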